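{- For every (undirected, simple, finite) graph $G$, $\operatorname{hn}(G_{C_4}) \leq \operatorname{hn}(G)$.
   Context: For an undirected graph $G$: $I_G(S)$ is the set of vertices lying on some shortest $u$–$v$ path with $u,v \in S$ (and $I_G(S)=S$ if $|S|\le 1$); $S$ is convex if $I_G(S)=S$; the hull of $S$ is the smallest convex set containing it; a hull set is a set whose hull is $V(G)$; $\operatorname{hn}(G)$ is the minimum size of a hull set. The same notions for an oriented graph $D$ are defined using directed geodesics (directed $(u,v)$-paths with minimum number of arcs, for all ordered pairs $u,v\in S$), giving $\operatorname{hn}(D)$. Given a graph $G$ with $V(G)=\{v_1,\dots,v_n\}$, $G_{C_4}$ is the oriented graph with vertex set $V(G) \cup \{v_{i,j}, v_{j,i} : v_iv_j \in E(G)\}$ and arc set $\{(v_i,v_{i,j}),(v_{i,j},v_j),(v_j,v_{j,i}),(v_{j,i},v_i) : v_iv_j \in E(G)\}$; i.e. each edge of $G$ is replaced by a directed $4$-cycle. -}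

module Defs where

open import Data.Nat using (ℕ; zero; suc; _<_; _≤_)
open import Data.Fin using (Fin)
open import Data.Bool using (Bool; true; false; T)
open import Data.List using (List; length)
open import Data.List.Membership.Propositional using (_∈_)
open import Data.Product using (Σ; ∃; _×_; _,_)
open import Relation.Nullary using (¬_)
open import Relation.Binary.PropositionalEquality using (_≡_)

record Graph (n : ℕ) : Set where
  field
    adj     : Fin n → Fin n → Bool
    adj-sym : ∀ i j → adj i j ≡ adj j i
    adj-irr : ∀ i → adj i i ≡ false

Edge : ∀ {n} → Graph n → Fin n → Fin n → Set
Edge G i j = T (Graph.adj G i j)

-- Generic geodesic notions for a (di)graph given by a relation R.
-- For an undirected graph R is the symmetric edge relation, so directed
-- walks along R are exactly undirected walks.

module _ {V : Set} (R : V → V → Set) where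

  data Walk : V → V → ℕ → Set where
    []  : ∀ {u} → Walk u u 0
    _∷_ : ∀ {u w v k} → R u w → Walk w v k → Walk u v (suc k)

  data OnWalk (x : V) : ∀ {u v k} → Walk u v k → Set where
    here  : ∀ {v k} {p : Walk x v k} → OnWalk x p
    there : ∀ {u w v k} {e : R u w} {p : Walk w v k} →
            OnWalk x p → OnWalk x (e ∷ p)

  Geodesic : ∀ {u v k} → Walk u v k → Set
  Geodesic {u} {v} {k} _ = ∀ m → m < k → ¬ Walk u v m

  Interval : (V → Set) → V → Set
  Interval S x = Σ V λ u → Σ V λ v → S u × S v ×
                 Σ ℕ λ k → Σ (Walk u v k) λ p → Geodesic p × OnWalk x p

  Convex : (V → Set) → Set
  Convex S = ∀ x → Interval S x → S x

  -- S is a hull set: its hull (the smallest convex set containing S, i.e.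
  -- the intersection of all convex supersets of S) is all of V
  IsHullSet : List V → Set₁
  IsHullSet S = (C : V → Set) → (∀ x → x ∈ S → C x) → Convex C → ∀ x → C x

module _ {n : ℕ} (G : Graph n) where

  -- orig i = v_i ; mid i j e = v_{i,j} for an edge v_i v_j
  data C4Vertex : Set where
    orig : Fin n → C4Vertex
    mid  : (i j : Fin n) → Edge G i j → C4Vertex

  -- arcs (v_i, v_{i,j}) and (v_{i,j}, v_j) for every ordered pair with v_i v_j ∈ E(G);
  -- ranging over both orders gives the four arcs of each directed 4-cycle
  data C4Arc : C4Vertex → C4Vertex → Set where
    out : ∀ i j (e : Edge G i j) → C4Arc (orig i) (mid i j e)
    inn : ∀ i j (e : Edge G i j) → C4Arc (mid i j e) (orig j)

{-# OPTIONS --safe #-}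
module Submission where

-- Walks of G correspond exactly to walks of G_{C4} between original vertices,
-- with every edge v_i v_j replaced by the two arcs v_i → v_{i,j} → v_j. Hence
-- G-geodesics lift to geodesics of G_{C4}, so the original vertices of a convex
-- set of G_{C4} form a convex set of G; if it contains a hull set S of G, it
-- contains every v_i. It then contains every v_{i,j} too, since v_{i,j} lies on
-- the geodesic v_i → v_{i,j} → v_j (G has no loops and G_{C4} no arc v_i → v_j).
-- So the copy of S in G_{C4} is a hull set of the same size.

open import Defs
open import Data.Nat using (ℕ; suc; _*_; _≤_; s≤s; z≤n)
open import Data.Nat.Properties using (*-cancelʳ-<; ≤-reflexive)
open import Data.Fin using (Fin)
open import Data.Bool using (T)
open import Data.List using (List; length; map)
open import Data.List.Properties using (length-map)
open import Data.List.Membership.Propositional.Properties using (∈-map⁺)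
open import Data.Product using (Σ; _×_; _,_)
open import Relation.Nullary using (¬_)
open import Relation.Binary.PropositionalEquality using (_≡_; refl; subst; cong)

module _ {n : ℕ} (G : Graph n) where

  private
    E : Fin n → Fin n → Set
    E = Edge G

    A : C4Vertex G → C4Vertex G → Set
    A = C4Arc G

  ¬loop : ∀ i → ¬ E i i
  ¬loop i = subst T (Graph.adj-irr G i)

  -- Lengths are written k * 2 so that suc k * 2 reduces to suc (suc (k * 2)).
  liftWalk : ∀ {u v k} → Walk E u v k → Walk A (orig u) (orig v) (k * 2)
  liftWalk []                = []
  liftWalk (_∷_ {u} {w} e p) = out u w e ∷ (inn u w e ∷ liftWalk p)

  onWalk-liftWalk : ∀ {x u v k} (p : Walk E u v k) →
                    OnWalk E x p → OnWalk A (orig x) (liftWalk p)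
  onWalk-liftWalk p       here      = here
  onWalk-liftWalk (e ∷ p) (there o) = there (there (onWalk-liftWalk p o))

  projectWalk : ∀ {u v m} → Walk A (orig u) (orig v) m →
                Σ ℕ λ k → Walk E u v k × k * 2 ≡ m
  projectWalk []                          = 0 , [] , refl
  projectWalk (out _ _ e ∷ (inn _ _ _ ∷ p)) with projectWalk p
  ... | k , q , refl = suc k , e ∷ q , refl

  geodesic-liftWalk : ∀ {u v k} (p : Walk E u v k) →
                      Geodesic E p → Geodesic A (liftWalk p)
  geodesic-liftWalk {k = k} p geo m m<2k q with projectWalk q
  ... | l , q′ , refl = geo l (*-cancelʳ-< 2 l k m<2k) q′

  geodesic-out-inn : ∀ i j (e : E i j) → Geodesic A (out i j e ∷ (inn i j e ∷ []))
  geodesic-out-inn i .i e 0 _                 [] = ¬loop i e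
  geodesic-out-inn i j  e 1 (s≤s (s≤s z≤n)) (() ∷ [])

  convex-orig : (C : C4Vertex G → Set) → Convex A C → Convex E (λ i → C (orig i))
  convex-orig C conv x (u , v , Cu , Cv , k , p , geo , on) =
    conv (orig x) (orig u , orig v , Cu , Cv , k * 2 , liftWalk p ,
                   geodesic-liftWalk p geo , onWalk-liftWalk p on)

  isHullSet-map-orig : (S : List (Fin n)) → IsHullSet E S → IsHullSet A (map orig S)
  isHullSet-map-orig S hull C S⊆C conv = contains
    where
      contains-orig : ∀ i → C (orig i)
      contains-orig = hull (λ i → C (orig i)) (λ i i∈S → S⊆C (orig i) (∈-map⁺ orig i∈S))
                           (convex-orig C conv)

      contains : ∀ x → C x
      contains (orig i)    = contains-orig i
      contains (mid i j e) =
        conv (mid i j e) (orig i , orig j , contains-orig i , contains-orig j ,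
                          2 , out i j e ∷ (inn i j e ∷ []) , geodesic-out-inn i j e ,
                          there here)

lemma3 : ∀ {n} (G : Graph n) (S : List (Fin n)) → IsHullSet (Edge G) S →
    Σ (List (C4Vertex G)) λ S′ → IsHullSet (C4Arc G) S′ × length S′ ≤ length S
lemma3 G S hull = map orig S , isHullSet-map-orig G S hull , ≤-reflexive (length-map orig S)
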